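{- Let $N$ be a nonnegative integer and $\alpha,\beta,\gamma,\delta\in\mathbb{C}$ with $\alpha+\beta=-1$ and with $\alpha+1=-N$ or $\beta+\delta+1=-N$ or $\gamma+1=-N$, such that the Racah polynomials $R_k(\lambda(x);\alpha,\beta,\gamma,\delta)$, $0\le k\le N$, are well-defined. Let $x\in\mathbb{C}$. Then for every $0\le n\le N$, $$\sum_{k=0}^n\frac{(-n)_k}{(1+n)_k}R_k(\lambda(x);\alpha,\beta,\gamma,\delta)=\frac{n!\,(-x)_n(x+\gamma+\delta+1)_n+(\alpha+1)_n(\beta+\delta+1)_n(\gamma+1)_n}{2(\alpha+1)_n(\beta+\delta+1)_n(\gamma+1)_n}.$$
   Context: Rising factorial: $(\gamma)_0=1$, $(\gamma)_k=\gamma(\gamma+1)\cdots(\gamma+k-1)$. With $\lambda(x)=x(x+\gamma+\delta+1)$, the Racah polynomials are, for $0\le n\le N$, $R_n(\lambda(x);\alpha,\beta,\gamma,\delta)=\sum_{j=0}^n\frac{(-n)_j(n+\alpha+\beta+1)_j(-x)_j(x+\gamma+\delta+1)_j}{j!\,(\alpha+1)_j(\beta+\delta+1)_j(\gamma+1)_j}$ (a terminating ${}_4F_3(1)$ series; well-defined means no denominator factor vanishes). -}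

module Defs where

open import Level using (Level; _⊔_) renaming (suc to lsuc)
open import Data.Nat using (ℕ; zero; suc; _≤_)
open import Data.Nat using (_!)
open import Data.Product using (_×_)
open import Relation.Nullary using (¬_)
open import Algebra.Bundles using (CommutativeRing)

record Field (c ℓ : Level) : Set (lsuc (c ⊔ ℓ)) where
  field
    commutativeRing : CommutativeRing c ℓ
  open CommutativeRing commutativeRing public
  field
    _⁻¹     : Carrier → Carrier
    inverse : ∀ x → ¬ (x ≈ 0#) → (x * (x ⁻¹)) ≈ 1#

module FieldOps {c ℓ : Level} (F : Field c ℓ) where
  open Field F

  ι : ℕ → Carrier
  ι zero    = 0#
  ι (suc n) = 1# + ι n

  poch : Carrier → ℕ → Carrier
  poch g zero    = 1#
  poch g (suc k) = poch g k * (g + ι k)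

  sumTo : ℕ → (ℕ → Carrier) → Carrier
  sumTo zero    f = f 0
  sumTo (suc n) f = sumTo n f + f (suc n)

  _/_ : Carrier → Carrier → Carrier
  a / b = a * (b ⁻¹)

  -- λ(x) = x (x + γ + δ + 1)  (only used as notation; R_n is evaluated at λ(x)
  -- through x, exactly as in the defining 4F3 series)
  -- Racah polynomial R_n(λ(x); α, β, γ, δ)
  racah : Carrier → Carrier → Carrier → Carrier → ℕ → Carrier → Carrier
  racah α β γ δ n x =
    sumTo n (λ j →
      (poch (- ι n) j * poch (ι n + α + β + 1#) j * poch (- x) j
         * poch (x + γ + δ + 1#) j)
      / (ι (j !) * poch (α + 1#) j * poch (β + δ + 1#) j * poch (γ + 1#) j))

CharZero : ∀ {c ℓ} → Field c ℓ → Set ℓ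
CharZero F = ∀ n → ¬ (ι (suc n) ≈ 0#)
  where open Field F
        open FieldOps F

-- R_k, 0 ≤ k ≤ N, well-defined: no denominator factor of the 4F3 vanishes,
-- i.e. (α+1)_j, (β+δ+1)_j, (γ+1)_j ≠ 0 for 0 ≤ j ≤ N (j! ≠ 0 by char 0).
RacahWellDefined : ∀ {c ℓ} (F : Field c ℓ) → ℕ →
  (α β γ δ : Field.Carrier F) → Set ℓ
RacahWellDefined F N α β γ δ =
  ∀ j → j ≤ N →
    (¬ (poch (α + 1#) j ≈ 0#)) × (¬ (poch (β + δ + 1#) j ≈ 0#))
      × (¬ (poch (γ + 1#) j ≈ 0#))
  where open Field F
        open FieldOps F

module Submission where

-- With α + β + 1 = 0 the factor (k + α + β + 1)_j of the ₄F₃ series is (k)_j, so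
-- R_k = Σ_j (−k)_j (k)_j Y_j with Y_j independent of k. Exchanging the two sums turns the left-hand
-- side into Σ_j W_j Y_j with W_j = Σ_k (−n)_k / (1+n)_k · (−k)_j (k)_j. A Gosper certificate makes
-- the summand of W_j telescope, giving 2 (n − j) W_j = n [j = 0]; hence, for n ≥ 1, W_0 = 1/2 and
-- W_j = 0 for 0 < j < n, while W_n = (n!)²/2 because only k = n contributes to it. So only the
-- terms j = 0 and j = n survive, and they add up to the right-hand side.

open import Defs
open import Data.Nat using (ℕ; _≤_)
open import Data.Nat using (_!)
open import Data.Sum using (_⊎_)
open import Algebra.Bundles using (CommutativeRing)
open import Algebra.Solver.Ring.AlmostCommutativeRing
  using (fromCommutativeRing; _-Raw-AlmostCommutative⟶_)
open import Data.Integer as ℤ using (ℤ; +_; -[1+_])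
import Data.Integer.Properties as ℤP
open import Data.Maybe using (Maybe; just; nothing)
open import Data.Nat as ℕ using (zero; suc; _<_; _∸_; _≤′_; z≤n; s≤s)
import Data.Nat.Properties as ℕP
open import Data.Product using (_,_)
open import Relation.Nullary using (¬_; yes; no)
import Relation.Binary.PropositionalEquality as ≡

-- Integer rather than carrier coefficients, so that normal forms cancel terms such as x - x.
module IntegerCoefficientSolver {c ℓ} (R : CommutativeRing c ℓ) where
  open CommutativeRing R
  open import Algebra.Properties.Ring ring
    using (-‿involutive; -‿+-comm; -‿distribˡ-*; -‿distribʳ-*; -0#≈0#)
  open import Algebra.Properties.Semiring.Mult semiring using (_×_; ×-homo-+; ×1-homo-*)
  open import Relation.Binary.Reasoning.Setoid setoid

  fromℤ : ℤ → Carrier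
  fromℤ (+ n)    = n × 1#
  fromℤ -[1+ n ] = - (suc n × 1#)

  fromℤ-homo-- : ∀ i → fromℤ (ℤ.- i) ≈ - fromℤ i
  fromℤ-homo-- (+ zero)  = sym -0#≈0#
  fromℤ-homo-- (+ suc n) = refl
  fromℤ-homo-- -[1+ n ]  = sym (-‿involutive _)

  -‿cancel-+ˡ : ∀ a x y → (a + x) - (a + y) ≈ x - y
  -‿cancel-+ˡ a x y = begin
    (a + x) - (a + y)       ≈⟨ +-congˡ (-‿+-comm a y) ⟨
    (a + x) + (- a + - y)   ≈⟨ +-congʳ (+-comm a x) ⟩
    (x + a) + (- a + - y)   ≈⟨ +-assoc x a _ ⟩
    x + (a + (- a + - y))   ≈⟨ +-congˡ (+-assoc a (- a) (- y)) ⟨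
    x + ((a - a) + - y)     ≈⟨ +-congˡ (+-congʳ (-‿inverseʳ a)) ⟩
    x + (0# + - y)          ≈⟨ +-congˡ (+-identityˡ (- y)) ⟩
    x - y                   ∎

  fromℤ-homo-⊖ : ∀ m n → fromℤ (m ℤ.⊖ n) ≈ m × 1# - n × 1#
  fromℤ-homo-⊖ m       zero    = sym (trans (+-congˡ -0#≈0#) (+-identityʳ _))
  fromℤ-homo-⊖ zero    (suc n) = sym (+-identityˡ _)
  fromℤ-homo-⊖ (suc m) (suc n) = begin
    fromℤ (suc m ℤ.⊖ suc n)         ≡⟨ ≡.cong fromℤ (ℤP.[1+m]⊖[1+n]≡m⊖n m n) ⟩
    fromℤ (m ℤ.⊖ n)                 ≈⟨ fromℤ-homo-⊖ m n ⟩
    m × 1# - n × 1#                 ≈⟨ -‿cancel-+ˡ 1# (m × 1#) (n × 1#) ⟨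
    (1# + m × 1#) - (1# + n × 1#)   ∎

  fromℤ-homo-+ : ∀ i j → fromℤ (i ℤ.+ j) ≈ fromℤ i + fromℤ j
  fromℤ-homo-+ (+ m)    (+ n)    = ×-homo-+ 1# m n
  fromℤ-homo-+ (+ m)    -[1+ n ] = fromℤ-homo-⊖ m (suc n)
  fromℤ-homo-+ -[1+ m ] (+ n)    = trans (fromℤ-homo-⊖ n (suc m)) (+-comm _ _)
  fromℤ-homo-+ -[1+ m ] -[1+ n ] = begin
    - (suc (suc (m ℕ.+ n)) × 1#)      ≡⟨ ≡.cong (λ k → - (suc k × 1#)) (ℕP.+-suc m n) ⟨
    - ((suc m ℕ.+ suc n) × 1#)        ≈⟨ -‿cong (×-homo-+ 1# (suc m) (suc n)) ⟩
    - (suc m × 1# + suc n × 1#)       ≈⟨ -‿+-comm _ _ ⟨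
    - (suc m × 1#) + - (suc n × 1#)   ∎

  fromℤ-homo-*-+ : ∀ m j → fromℤ (+ m ℤ.* j) ≈ m × 1# * fromℤ j
  fromℤ-homo-*-+ m (+ n)    =
    trans (reflexive (≡.cong fromℤ (≡.sym (ℤP.pos-* m n)))) (×1-homo-* m n)
  fromℤ-homo-*-+ m -[1+ n ] = begin
    fromℤ (+ m ℤ.* -[1+ n ])          ≡⟨ ≡.cong fromℤ (ℤP.neg-distribʳ-* (+ m) (+ suc n)) ⟨
    fromℤ (ℤ.- (+ m ℤ.* + suc n))     ≈⟨ fromℤ-homo-- (+ m ℤ.* + suc n) ⟩
    - fromℤ (+ m ℤ.* + suc n)         ≈⟨ -‿cong (fromℤ-homo-*-+ m (+ suc n)) ⟩
    - (m × 1# * (suc n × 1#))         ≈⟨ -‿distribʳ-* _ _ ⟩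
    m × 1# * - (suc n × 1#)           ∎

  fromℤ-homo-* : ∀ i j → fromℤ (i ℤ.* j) ≈ fromℤ i * fromℤ j
  fromℤ-homo-* (+ m)    j = fromℤ-homo-*-+ m j
  fromℤ-homo-* -[1+ m ] j = begin
    fromℤ (-[1+ m ] ℤ.* j)            ≡⟨ ≡.cong fromℤ (ℤP.neg-distribˡ-* (+ suc m) j) ⟨
    fromℤ (ℤ.- (+ suc m ℤ.* j))       ≈⟨ fromℤ-homo-- (+ suc m ℤ.* j) ⟩
    - fromℤ (+ suc m ℤ.* j)           ≈⟨ -‿cong (fromℤ-homo-*-+ (suc m) j) ⟩
    - (suc m × 1# * fromℤ j)          ≈⟨ -‿distribˡ-* _ _ ⟩
    - (suc m × 1#) * fromℤ j          ∎

  fromℤ-morphism : ℤ.+-*-rawRing -Raw-AlmostCommutative⟶ fromCommutativeRing R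
  fromℤ-morphism = record
    { ⟦_⟧    = fromℤ
    ; +-homo = fromℤ-homo-+
    ; *-homo = fromℤ-homo-*
    ; -‿homo = fromℤ-homo--
    ; 0-homo = refl
    ; 1-homo = +-identityʳ 1#
    }

  fromℤ-≟ : ∀ i j → Maybe (fromℤ i ≈ fromℤ j)
  fromℤ-≟ i j with i ℤ.≟ j
  ... | yes ≡.refl = just refl
  ... | no _       = nothing

  open import Algebra.Solver.Ring ℤ.+-*-rawRing (fromCommutativeRing R) fromℤ-morphism fromℤ-≟
    public

module FieldLemmas {c ℓ} (F : Field c ℓ) where
  open Field F hiding (zero)
  open FieldOps F
  open IntegerCoefficientSolver commutativeRing using (solve; _:=_; _:+_; _:-_; _:*_; :-_)
  open import Algebra.Properties.Semiring.Mult semiring using (_×_; ×-homo-+; ×1-homo-*)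
  open import Relation.Binary.Reasoning.Setoid setoid

  ⁻¹-inverseˡ : ∀ {x} → ¬ x ≈ 0# → x ⁻¹ * x ≈ 1#
  ⁻¹-inverseˡ {x} x≉0 = trans (*-comm _ _) (inverse x x≉0)

  *-cancelˡ : ∀ {a x y} → ¬ a ≈ 0# → a * x ≈ a * y → x ≈ y
  *-cancelˡ {a} {x} {y} a≉0 ax≈ay = begin
    x               ≈⟨ *-identityˡ x ⟨
    1# * x          ≈⟨ *-congʳ (⁻¹-inverseˡ a≉0) ⟨
    (a ⁻¹ * a) * x  ≈⟨ *-assoc _ _ _ ⟩
    a ⁻¹ * (a * x)  ≈⟨ *-congˡ ax≈ay ⟩
    a ⁻¹ * (a * y)  ≈⟨ *-assoc _ _ _ ⟨
    (a ⁻¹ * a) * y  ≈⟨ *-congʳ (⁻¹-inverseˡ a≉0) ⟩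
    1# * y          ≈⟨ *-identityˡ y ⟩
    y               ∎

  *-cancelʳ : ∀ {a x y} → ¬ a ≈ 0# → x * a ≈ y * a → x ≈ y
  *-cancelʳ a≉0 xa≈ya = *-cancelˡ a≉0 (trans (*-comm _ _) (trans xa≈ya (*-comm _ _)))

  *-≉0 : ∀ {a b} → ¬ a ≈ 0# → ¬ b ≈ 0# → ¬ a * b ≈ 0#
  *-≉0 {a} a≉0 b≉0 ab≈0 = b≉0 (*-cancelˡ a≉0 (trans ab≈0 (sym (zeroʳ a))))

  ⁻¹-unique : ∀ {a b} → ¬ a ≈ 0# → a * b ≈ 1# → b ≈ a ⁻¹
  ⁻¹-unique {a} a≉0 ab≈1 = *-cancelˡ a≉0 (trans ab≈1 (sym (inverse a a≉0)))

  ⁻¹-distrib-* : ∀ {a b} → ¬ a ≈ 0# → ¬ b ≈ 0# → (a * b) ⁻¹ ≈ a ⁻¹ * b ⁻¹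
  ⁻¹-distrib-* {a} {b} a≉0 b≉0 = sym (⁻¹-unique (*-≉0 a≉0 b≉0) (begin
    (a * b) * (a ⁻¹ * b ⁻¹)
      ≈⟨ solve 4 (λ a b a′ b′ → (a :* b) :* (a′ :* b′) := (a :* a′) :* (b :* b′))
           refl a b (a ⁻¹) (b ⁻¹) ⟩
    (a * a ⁻¹) * (b * b ⁻¹)    ≈⟨ *-cong (inverse a a≉0) (inverse b b≉0) ⟩
    1# * 1#                    ≈⟨ *-identityˡ 1# ⟩
    1#                         ∎))

  x/y*y≈x : ∀ {x y} → ¬ y ≈ 0# → (x / y) * y ≈ x
  x/y*y≈x {x} {y} y≉0 = begin
    (x * y ⁻¹) * y    ≈⟨ *-assoc _ _ _ ⟩
    x * (y ⁻¹ * y)    ≈⟨ *-congˡ (⁻¹-inverseˡ y≉0) ⟩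
    x * 1#            ≈⟨ *-identityʳ x ⟩
    x                 ∎

  x*y≈z⇒x≈z/y : ∀ {x y z} → ¬ y ≈ 0# → x * y ≈ z → x ≈ z / y
  x*y≈z⇒x≈z/y y≉0 xy≈z = *-cancelʳ y≉0 (trans xy≈z (sym (x/y*y≈x y≉0)))

  sumTo-cong : ∀ m {f g} → (∀ j → j ≤ m → f j ≈ g j) → sumTo m f ≈ sumTo m g
  sumTo-cong zero    f≈g = f≈g 0 z≤n
  sumTo-cong (suc m) f≈g =
    +-cong (sumTo-cong m (λ j j≤m → f≈g j (ℕP.m≤n⇒m≤1+n j≤m))) (f≈g (suc m) ℕP.≤-refl)

  sumTo-distribˡ : ∀ m a f → a * sumTo m f ≈ sumTo m (λ j → a * f j)
  sumTo-distribˡ zero    a f = refl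
  sumTo-distribˡ (suc m) a f = trans (distribˡ a _ _) (+-congʳ (sumTo-distribˡ m a f))

  sumTo-distribʳ : ∀ m a f → sumTo m f * a ≈ sumTo m (λ j → f j * a)
  sumTo-distribʳ zero    a f = refl
  sumTo-distribʳ (suc m) a f = trans (distribʳ a _ _) (+-congʳ (sumTo-distribʳ m a f))

  sumTo-+ : ∀ m f g → sumTo m (λ j → f j + g j) ≈ sumTo m f + sumTo m g
  sumTo-+ zero    f g = refl
  sumTo-+ (suc m) f g = trans (+-congʳ (sumTo-+ m f g))
    (solve 4 (λ a b c d → (a :+ b) :+ (c :+ d) := (a :+ c) :+ (b :+ d))
       refl (sumTo m f) (sumTo m g) (f (suc m)) (g (suc m)))

  sumTo-swap : ∀ m n (f : ℕ → ℕ → Carrier) →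
    sumTo m (λ k → sumTo n (f k)) ≈ sumTo n (λ j → sumTo m (λ k → f k j))
  sumTo-swap zero    n f = refl
  sumTo-swap (suc m) n f = trans (+-congʳ (sumTo-swap m n f)) (sym (sumTo-+ n _ _))

  sumTo-telescope : ∀ m (b : ℕ → Carrier) →
    sumTo m (λ k → b k - b (suc k)) ≈ b 0 - b (suc m)
  sumTo-telescope zero    b = refl
  sumTo-telescope (suc m) b = trans (+-congʳ (sumTo-telescope m b))
    (solve 3 (λ x y z → (x :- y) :+ (y :- z) := x :- z)
       refl (b 0) (b (suc m)) (b (suc (suc m))))

  sumTo-extend : ∀ {m n f} → m ≤ n → (∀ j → m ≤ j → j < n → f (suc j) ≈ 0#) →
    sumTo m f ≈ sumTo n f
  sumTo-extend {f = f} m≤n = go (ℕP.≤⇒≤′ m≤n)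
    where
    go : ∀ {m n} → m ≤′ n → (∀ j → m ≤ j → j < n → f (suc j) ≈ 0#) →
      sumTo m f ≈ sumTo n f
    go ℕ.≤′-refl _ = refl
    go {m} {suc n} (ℕ.≤′-step m≤′n) tail≈0 = begin
      sumTo m f
        ≈⟨ go m≤′n (λ j m≤j j<n → tail≈0 j m≤j (ℕP.m<n⇒m<1+n j<n)) ⟩
      sumTo n f               ≈⟨ +-identityʳ _ ⟨
      sumTo n f + 0#          ≈⟨ +-congˡ (tail≈0 n (ℕP.≤′⇒≤ m≤′n) (ℕP.n<1+n n)) ⟨
      sumTo n f + f (suc n)   ∎

  sumTo-last : ∀ m f → (∀ j → j < m → f j ≈ 0#) → sumTo m f ≈ f m
  sumTo-last zero    f init≈0 = refl
  sumTo-last (suc m) f init≈0 = begin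
    sumTo m f + f (suc m)
      ≈⟨ +-congʳ (sumTo-extend z≤n (λ j _ j<m → init≈0 (suc j) (s≤s j<m))) ⟨
    f 0 + f (suc m)         ≈⟨ +-congʳ (init≈0 0 (s≤s z≤n)) ⟩
    0# + f (suc m)          ≈⟨ +-identityˡ _ ⟩
    f (suc m)               ∎

  sumTo-endpoints : ∀ m f → (∀ j → j < m → f (suc j) ≈ 0#) →
    sumTo (suc m) f ≈ f 0 + f (suc m)
  sumTo-endpoints m f inner≈0 =
    +-congʳ (sym (sumTo-extend z≤n (λ j _ j<m → inner≈0 j j<m)))

  ι≈×1 : ∀ n → ι n ≈ n × 1#
  ι≈×1 zero    = refl
  ι≈×1 (suc n) = +-congˡ (ι≈×1 n)

  ι-homo-+ : ∀ m n → ι (m ℕ.+ n) ≈ ι m + ι n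
  ι-homo-+ m n = trans (ι≈×1 (m ℕ.+ n))
    (trans (×-homo-+ 1# m n) (sym (+-cong (ι≈×1 m) (ι≈×1 n))))

  ι-homo-* : ∀ m n → ι (m ℕ.* n) ≈ ι m * ι n
  ι-homo-* m n = trans (ι≈×1 (m ℕ.* n))
    (trans (×1-homo-* m n) (sym (*-cong (ι≈×1 m) (ι≈×1 n))))

  ι-homo-∸ : ∀ {m n} → n ≤ m → ι (m ∸ n) ≈ ι m - ι n
  ι-homo-∸ {m} {n} n≤m = begin
    ι (m ∸ n)
      ≈⟨ solve 2 (λ d t → d := (d :+ t) :- t) refl (ι (m ∸ n)) (ι n) ⟩
    (ι (m ∸ n) + ι n) - ι n     ≈⟨ +-congʳ (ι-homo-+ (m ∸ n) n) ⟨
    ι (m ∸ n ℕ.+ n) - ι n       ≡⟨ ≡.cong (λ k → ι k - ι n) (ℕP.m∸n+n≡m n≤m) ⟩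
    ι m - ι n                   ∎

  poch-cong : ∀ {a b} k → a ≈ b → poch a k ≈ poch b k
  poch-cong zero    a≈b = refl
  poch-cong (suc k) a≈b = *-cong (poch-cong k a≈b) (+-congʳ a≈b)

  poch-shift : ∀ a k → poch a (suc k) ≈ a * poch (1# + a) k
  poch-shift a zero    = trans (*-identityˡ _) (trans (+-identityʳ a) (sym (*-identityʳ a)))
  poch-shift a (suc k) = begin
    poch a (suc k) * (a + (1# + ι k))          ≈⟨ *-congʳ (poch-shift a k) ⟩
    (a * poch (1# + a) k) * (a + (1# + ι k))
      ≈⟨ solve 4 (λ a p o t → (a :* p) :* (a :+ (o :+ t)) := a :* (p :* ((o :+ a) :+ t)))
           refl a (poch (1# + a) k) 1# (ι k) ⟩
    a * (poch (1# + a) k * ((1# + a) + ι k))   ∎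

  poch-vanishes : ∀ {a m} k → a + ι m ≈ 0# → m < k → poch a k ≈ 0#
  poch-vanishes (suc k) a+m≈0 (s≤s m≤k) with ℕP.≤⇒≤′ m≤k
  ... | ℕ.≤′-refl      = trans (*-congˡ a+m≈0) (zeroʳ _)
  ... | ℕ.≤′-step m≤′k =
    trans (*-congʳ (poch-vanishes k a+m≈0 (s≤s (ℕP.≤′⇒≤ m≤′k)))) (zeroˡ _)

  poch-neg-square : ∀ m → poch (- ι m) m * poch (- ι m) m ≈ ι (m !) * ι (m !)
  poch-neg-square zero    = sym (*-cong (+-identityʳ 1#) (+-identityʳ 1#))
  poch-neg-square (suc m) = begin
    poch (- ι (suc m)) (suc m) * poch (- ι (suc m)) (suc m)   ≈⟨ *-cong shift shift ⟩
    (- ι (suc m) * q) * (- ι (suc m) * q)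
      ≈⟨ solve 2 (λ s q → (:- s :* q) :* (:- s :* q) := (s :* s) :* (q :* q))
           refl (ι (suc m)) q ⟩
    (ι (suc m) * ι (suc m)) * (q * q)                         ≈⟨ *-congˡ (poch-neg-square m) ⟩
    (ι (suc m) * ι (suc m)) * (ι (m !) * ι (m !))
      ≈⟨ solve 2 (λ s f → (s :* s) :* (f :* f) := (s :* f) :* (s :* f))
           refl (ι (suc m)) (ι (m !)) ⟩
    (ι (suc m) * ι (m !)) * (ι (suc m) * ι (m !))
      ≈⟨ *-cong (ι-homo-* (suc m) (m !)) (ι-homo-* (suc m) (m !)) ⟨
    ι (suc m !) * ι (suc m !)                                 ∎
    where
    q : Carrier
    q = poch (- ι m) m
    shift : poch (- ι (suc m)) (suc m) ≈ - ι (suc m) * q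
    shift = trans (poch-shift _ m) (*-congˡ (poch-cong m
      (solve 2 (λ o t → o :+ :- (o :+ t) := :- t) refl 1# (ι m))))

module RacahLemmas {c ℓ} (F : Field c ℓ) (cz : CharZero F) where
  open Field F hiding (zero)
  open FieldOps F
  open FieldLemmas F
  open IntegerCoefficientSolver commutativeRing using (solve; _:=_; _:+_; _:-_; _:*_; :-_; con)
  open import Algebra.Properties.Ring ring using (x[y-z]≈xy-xz)
  open import Algebra.Properties.CommutativeSemigroup *-commutativeSemigroup using (x∙yz≈y∙xz)
  open import Relation.Binary.Reasoning.Setoid setoid

  ι≉0 : ∀ {m} → 1 ≤ m → ¬ ι m ≈ 0#
  ι≉0 {suc m} _ = cz m

  1#≉0# : ¬ 1# ≈ 0#
  1#≉0# 1≈0 = cz 0 (trans (+-identityʳ 1#) 1≈0)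

  poch-≉0 : ∀ {a} k → (∀ i → i < k → ¬ a + ι i ≈ 0#) → ¬ poch a k ≈ 0#
  poch-≉0 zero    factors≉0 = 1#≉0#
  poch-≉0 (suc k) factors≉0 =
    *-≉0 (poch-≉0 k (λ i i<k → factors≉0 i (ℕP.m<n⇒m<1+n i<k))) (factors≉0 k (ℕP.n<1+n k))

  1+m+n≉0 : ∀ m n → ¬ (1# + ι m) + ι n ≈ 0#
  1+m+n≉0 m n e = cz (m ℕ.+ n) (trans (ι-homo-+ (suc m) n) e)

  poch[1+n]≉0 : ∀ n k → ¬ poch (1# + ι n) k ≈ 0#
  poch[1+n]≉0 n k = poch-≉0 k (λ i _ → 1+m+n≉0 n i)

  double-poch-diagonal : ∀ {n} → 1 ≤ n → ι 2 * poch (ι n) n ≈ poch (1# + ι n) n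
  double-poch-diagonal {n} 1≤n = *-cancelˡ (ι≉0 1≤n) (begin
    ι n * (ι 2 * poch (ι n) n)
      ≈⟨ solve 2 (λ t p → t :* (con (+ 2) :* p) := p :* (t :+ t)) refl (ι n) (poch (ι n) n) ⟩
    poch (ι n) (suc n)          ≈⟨ poch-shift (ι n) n ⟩
    ι n * poch (1# + ι n) n     ∎)

  pochPair : Carrier → ℕ → Carrier
  pochPair y j = poch (- y) j * poch y j

  shiftedPochPair : Carrier → ℕ → Carrier
  shiftedPochPair y j = poch (1# - y) j * poch y j

  pochPair-vanishes : ∀ {k j} → k < j → pochPair (ι k) j ≈ 0#
  pochPair-vanishes {k} {j} k<j =
    trans (*-congʳ (poch-vanishes j (-‿inverseˡ (ι k)) k<j)) (zeroˡ _)

  -- For j = i + 1 all three Pochhammer products are y (1 − y)_i (1 + y)_i times linear factors,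
  -- so the identity is a ring identity, valid also at y = 0 (no division by y).
  gosper-certificate : ∀ n j y →
    (y + ι n) * shiftedPochPair y j - (y - ι n) * shiftedPochPair (1# + y) j
      ≈ ι 2 * (ι n - ι j) * pochPair y j
  gosper-certificate n zero y =
    solve 3 (λ y t p → (y :+ t) :* p :- (y :- t) :* p := con (+ 2) :* (t :- con (+ 0)) :* p)
      refl y (ι n) (1# * 1#)
  gosper-certificate n (suc i) y = begin
    (y + ι n) * shiftedPochPair y (suc i) - (y - ι n) * shiftedPochPair (1# + y) (suc i)
      ≈⟨ +-cong (*-congˡ (*-congˡ (poch-shift y i)))
                (-‿cong (*-congˡ (*-congʳ (trans (poch-cong (suc i) 1-[1+y]≈-y)
                                                 (poch-shift (- y) i))))) ⟩
    (y + ι n) * ((a * ((1# - y) + ι i)) * (y * b))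
      - (y - ι n) * ((- y * a) * (b * ((1# + y) + ι i)))
      ≈⟨ solve 6 (λ y t s a b o →
           (y :+ t) :* ((a :* ((o :- y) :+ s)) :* (y :* b))
             :- (y :- t) :* ((:- y :* a) :* (b :* ((o :+ y) :+ s)))
           := con (+ 2) :* (t :- (o :+ s)) :* ((:- y :* a) :* (y :* b)))
           refl y (ι n) (ι i) a b 1# ⟩
    ι 2 * (ι n - ι (suc i)) * ((- y * a) * (y * b))
      ≈⟨ *-congˡ (*-cong (poch-shift (- y) i) (poch-shift y i)) ⟨
    ι 2 * (ι n - ι (suc i)) * pochPair y (suc i)    ∎
    where
    a b : Carrier
    a = poch (1# - y) i
    b = poch (1# + y) i
    1-[1+y]≈-y : 1# - (1# + y) ≈ - y
    1-[1+y]≈-y = solve 2 (λ o y → o :- (o :+ y) := :- y) refl 1# y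

  weight : ℕ → ℕ → Carrier
  weight n k = poch (- ι n) k / poch (1# + ι n) k

  weight-zero : ∀ n → weight n 0 ≈ 1#
  weight-zero n = inverse 1# 1#≉0#

  weight-vanishes : ∀ n → weight n (suc n) ≈ 0#
  weight-vanishes n =
    trans (*-congʳ (poch-vanishes (suc n) (-‿inverseˡ (ι n)) (ℕP.n<1+n n))) (zeroˡ _)

  weight-step : ∀ n k → weight n (suc k) * (ι (suc k) + ι n) ≈ weight n k * (ι k - ι n)
  weight-step n k = begin
    (p * (- ι n + ι k)) * (q * e) ⁻¹ * ((1# + ι k) + ι n)
      ≈⟨ *-congʳ (*-congˡ (⁻¹-distrib-* (poch[1+n]≉0 n k) (1+m+n≉0 n k))) ⟩
    (p * (- ι n + ι k)) * (q ⁻¹ * e ⁻¹) * ((1# + ι k) + ι n)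
      ≈⟨ solve 6 (λ p q′ e′ o t s →
           (p :* (:- t :+ s)) :* (q′ :* e′) :* ((o :+ s) :+ t)
             := (p :* q′) :* (s :- t) :* (e′ :* ((o :+ t) :+ s)))
           refl p (q ⁻¹) (e ⁻¹) 1# (ι n) (ι k) ⟩
    weight n k * (ι k - ι n) * (e ⁻¹ * e)    ≈⟨ *-congˡ (⁻¹-inverseˡ (1+m+n≉0 n k)) ⟩
    weight n k * (ι k - ι n) * 1#            ≈⟨ *-identityʳ _ ⟩
    weight n k * (ι k - ι n)                 ∎
    where
    p q e : Carrier
    p = poch (- ι n) k
    q = poch (1# + ι n) k
    e = (1# + ι n) + ι k

  weightedPairSum : ℕ → ℕ → Carrier
  weightedPairSum n j = sumTo n (λ k → weight n k * pochPair (ι k) j)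

  weightedPairSum-identity : ∀ n j →
    ι 2 * (ι n - ι j) * weightedPairSum n j ≈ ι n * shiftedPochPair 0# j
  weightedPairSum-identity n j = begin
    d * weightedPairSum n j                               ≈⟨ sumTo-distribˡ n d _ ⟩
    sumTo n (λ k → d * (weight n k * pochPair (ι k) j))
      ≈⟨ sumTo-cong n (λ k _ → telescoping k) ⟩
    sumTo n (λ k → b k - b (suc k))                       ≈⟨ sumTo-telescope n b ⟩
    b 0 - b (suc n)
      ≈⟨ +-cong (trans (*-congʳ (weight-zero n)) (*-identityˡ _))
                (-‿cong (trans (*-congʳ (weight-vanishes n)) (zeroˡ _))) ⟩
    (0# + ι n) * shiftedPochPair 0# j - 0#
      ≈⟨ solve 2 (λ t s → (con (+ 0) :+ t) :* s :- con (+ 0) := t :* s)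
           refl (ι n) (shiftedPochPair 0# j) ⟩
    ι n * shiftedPochPair 0# j                            ∎
    where
    d : Carrier
    d = ι 2 * (ι n - ι j)
    b : ℕ → Carrier
    b k = weight n k * ((ι k + ι n) * shiftedPochPair (ι k) j)
    telescoping : ∀ k → d * (weight n k * pochPair (ι k) j) ≈ b k - b (suc k)
    telescoping k = begin
      d * (w * pochPair (ι k) j)                 ≈⟨ x∙yz≈y∙xz d w _ ⟩
      w * (d * pochPair (ι k) j)                 ≈⟨ *-congˡ (gosper-certificate n j (ι k)) ⟨
      w * ((ι k + ι n) * s - (ι k - ι n) * s′)   ≈⟨ x[y-z]≈xy-xz w _ _ ⟩
      b k - w * ((ι k - ι n) * s′)               ≈⟨ +-congˡ (-‿cong (*-assoc w _ s′)) ⟨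
      b k - (w * (ι k - ι n)) * s′
        ≈⟨ +-congˡ (-‿cong (*-congʳ (weight-step n k))) ⟨
      b k - (weight n (suc k) * (ι (suc k) + ι n)) * s′
                                                 ≈⟨ +-congˡ (-‿cong (*-assoc _ _ s′)) ⟩
      b k - b (suc k)                            ∎
      where
      w s s′ : Carrier
      w = weight n k
      s = shiftedPochPair (ι k) j
      s′ = shiftedPochPair (1# + ι k) j

  weightedPairSum-zero : ∀ {n} → 1 ≤ n → ι 2 * weightedPairSum n 0 ≈ 1#
  weightedPairSum-zero {n} 1≤n = *-cancelˡ (ι≉0 1≤n) (begin
    ι n * (ι 2 * weightedPairSum n 0)
      ≈⟨ solve 2 (λ t w → t :* (con (+ 2) :* w) := con (+ 2) :* (t :- con (+ 0)) :* w)
           refl (ι n) (weightedPairSum n 0) ⟩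
    ι 2 * (ι n - ι 0) * weightedPairSum n 0   ≈⟨ weightedPairSum-identity n 0 ⟩
    ι n * (1# * 1#)                           ≈⟨ *-congˡ (*-identityˡ 1#) ⟩
    ι n * 1#                                  ∎)

  weightedPairSum-middle : ∀ {n j} → suc j < n → weightedPairSum n (suc j) ≈ 0#
  weightedPairSum-middle {n} {j} 1+j<n = *-cancelˡ d≉0 (begin
    d * weightedPairSum n (suc j)       ≈⟨ weightedPairSum-identity n (suc j) ⟩
    ι n * shiftedPochPair 0# (suc j)
      ≈⟨ *-congˡ (*-congˡ (poch-vanishes (suc j) (+-identityʳ 0#) (s≤s z≤n))) ⟩
    ι n * (poch (1# - 0#) (suc j) * 0#) ≈⟨ *-congˡ (zeroʳ _) ⟩
    ι n * 0#                            ≈⟨ zeroʳ _ ⟩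
    0#                                  ≈⟨ zeroʳ d ⟨
    d * 0#                              ∎)
    where
    d : Carrier
    d = ι 2 * (ι n - ι (suc j))
    d≉0 : ¬ d ≈ 0#
    d≉0 = *-≉0 (ι≉0 {2} (s≤s z≤n))
      (λ e → ι≉0 (ℕP.m<n⇒0<n∸m 1+j<n) (trans (ι-homo-∸ (ℕP.<⇒≤ 1+j<n)) e))

  weightedPairSum-top : ∀ {n} → 1 ≤ n → ι 2 * weightedPairSum n n ≈ ι (n !) * ι (n !)
  weightedPairSum-top {n} 1≤n = begin
    ι 2 * weightedPairSum n n
      ≈⟨ *-congˡ (sumTo-last n _ (λ k k<n → trans (*-congˡ (pochPair-vanishes k<n)) (zeroʳ _))) ⟩
    ι 2 * ((p * q ⁻¹) * (p * r))
      ≈⟨ solve 4 (λ p q′ r t → t :* ((p :* q′) :* (p :* r)) := (p :* p) :* ((t :* r) :* q′))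
           refl p (q ⁻¹) r (ι 2) ⟩
    (p * p) * ((ι 2 * r) * q ⁻¹)
      ≈⟨ *-cong (poch-neg-square n) (*-congʳ (double-poch-diagonal 1≤n)) ⟩
    ι (n !) * ι (n !) * (q * q ⁻¹) ≈⟨ *-congˡ (inverse q (poch[1+n]≉0 n n)) ⟩
    ι (n !) * ι (n !) * 1#         ≈⟨ *-identityʳ _ ⟩
    ι (n !) * ι (n !)              ∎
    where
    p q r : Carrier
    p = poch (- ι n) n
    q = poch (1# + ι n) n
    r = poch (ι n) n

  module Racah (α β γ δ x : Carrier) where

    racahNumerator : ℕ → Carrier
    racahNumerator j = poch (- x) j * poch (x + γ + δ + 1#) j

    racahDenominator : ℕ → Carrier
    racahDenominator j = ι (j !) * poch (α + 1#) j * poch (β + δ + 1#) j * poch (γ + 1#) j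

    racahFactor : ℕ → Carrier
    racahFactor j = racahNumerator j / racahDenominator j

    racah-as-sum : α + β ≈ - 1# → ∀ {k n} → k ≤ n →
      racah α β γ δ k x ≈ sumTo n (λ j → pochPair (ι k) j * racahFactor j)
    racah-as-sum α+β≈-1 {k} k≤n = trans (sumTo-cong k (λ j _ → term j))
      (sumTo-extend k≤n (λ j k≤j _ → trans (*-congʳ (pochPair-vanishes (s≤s k≤j))) (zeroˡ _)))
      where
      k+α+β+1≈k : ι k + α + β + 1# ≈ ι k
      k+α+β+1≈k = begin
        ι k + α + β + 1#
          ≈⟨ solve 4 (λ t a b o → t :+ a :+ b :+ o := t :+ ((a :+ b) :+ o)) refl (ι k) α β 1# ⟩
        ι k + ((α + β) + 1#)      ≈⟨ +-congˡ (trans (+-congʳ α+β≈-1) (-‿inverseˡ 1#)) ⟩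
        ι k + 0#                  ≈⟨ +-identityʳ (ι k) ⟩
        ι k                       ∎
      term : ∀ j →
        (poch (- ι k) j * poch (ι k + α + β + 1#) j * poch (- x) j * poch (x + γ + δ + 1#) j)
          / racahDenominator j
        ≈ pochPair (ι k) j * racahFactor j
      term j = trans (*-congʳ (*-congʳ (*-congʳ (*-congˡ (poch-cong j k+α+β+1≈k)))))
        (trans (*-congʳ (*-assoc _ _ _)) (*-assoc _ _ _))

    weighted-racah-sum : α + β ≈ - 1# → ∀ n →
      sumTo n (λ k → weight n k * racah α β γ δ k x)
        ≈ sumTo n (λ j → weightedPairSum n j * racahFactor j)
    weighted-racah-sum α+β≈-1 n = begin
      sumTo n (λ k → weight n k * racah α β γ δ k x)
        ≈⟨ sumTo-cong n (λ k k≤n → *-congˡ (racah-as-sum α+β≈-1 k≤n)) ⟩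
      sumTo n (λ k → weight n k * sumTo n (λ j → pochPair (ι k) j * racahFactor j))
        ≈⟨ sumTo-cong n (λ k _ → sumTo-distribˡ n (weight n k) _) ⟩
      sumTo n (λ k → sumTo n (λ j → weight n k * (pochPair (ι k) j * racahFactor j)))
        ≈⟨ sumTo-swap n n _ ⟩
      sumTo n (λ j → sumTo n (λ k → weight n k * (pochPair (ι k) j * racahFactor j)))
        ≈⟨ sumTo-cong n (λ j _ → sumTo-cong n (λ k _ → *-assoc _ _ _)) ⟨
      sumTo n (λ j → sumTo n (λ k → weight n k * pochPair (ι k) j * racahFactor j))
        ≈⟨ sumTo-cong n (λ j _ → sumTo-distribʳ n (racahFactor j) _) ⟨
      sumTo n (λ j → weightedPairSum n j * racahFactor j)
        ∎

    racahFactor-zero : racahFactor 0 ≈ 1#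
    racahFactor-zero = begin
      racahFactor 0                        ≈⟨ *-identityʳ _ ⟨
      racahFactor 0 * 1#                   ≈⟨ *-congˡ denominator≈1 ⟨
      racahFactor 0 * racahDenominator 0
        ≈⟨ x/y*y≈x (λ denominator≈0 → 1#≉0# (trans (sym denominator≈1) denominator≈0)) ⟩
      1# * 1#                              ≈⟨ *-identityˡ 1# ⟩
      1#                                   ∎
      where
      denominator≈1 : racahDenominator 0 ≈ 1#
      denominator≈1 =
        trans (*-identityʳ _) (trans (*-identityʳ _) (trans (*-identityʳ _) (+-identityʳ 1#)))

    closed-form-times-denominator : ∀ n →
      ¬ poch (α + 1#) n ≈ 0# → ¬ poch (β + δ + 1#) n ≈ 0# → ¬ poch (γ + 1#) n ≈ 0# →
      sumTo n (λ j → weightedPairSum n j * racahFactor j)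
          * (ι 2 * poch (α + 1#) n * poch (β + δ + 1#) n * poch (γ + 1#) n)
        ≈ ι (n !) * poch (- x) n * poch (x + γ + δ + 1#) n
            + poch (α + 1#) n * poch (β + δ + 1#) n * poch (γ + 1#) n
    closed-form-times-denominator zero _ _ _ = begin
      (weightedPairSum 0 0 * racahFactor 0) * (((ι 2 * 1#) * 1#) * 1#)
        ≈⟨ *-cong (*-cong weightedPairSum-0-0 racahFactor-zero) (*-identityʳ³ (ι 2)) ⟩
      (1# * 1#) * ι 2                   ≈⟨ trans (*-congʳ (*-identityˡ 1#)) (*-identityˡ _) ⟩
      1# + ι 1                          ≈⟨ +-comm 1# (ι 1) ⟩
      ι 1 + 1#                          ≈⟨ +-cong (*-identityʳ² (ι 1)) (*-identityʳ² 1#) ⟨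
      (ι 1 * 1#) * 1# + (1# * 1#) * 1#  ∎
      where
      *-identityʳ² : ∀ y → (y * 1#) * 1# ≈ y
      *-identityʳ² y = trans (*-identityʳ _) (*-identityʳ y)
      *-identityʳ³ : ∀ y → ((y * 1#) * 1#) * 1# ≈ y
      *-identityʳ³ y = trans (*-identityʳ _) (*-identityʳ² y)
      weightedPairSum-0-0 : weightedPairSum 0 0 ≈ 1#
      weightedPairSum-0-0 = trans (*-cong (weight-zero 0) (*-identityˡ 1#)) (*-identityˡ 1#)
    closed-form-times-denominator n@(suc m) a≉0 b≉0 c≉0 = begin
      sumTo n (λ j → weightedPairSum n j * racahFactor j) * (ι 2 * A * B * C)
        ≈⟨ *-congʳ (sumTo-endpoints m _ (λ j j<m →
             trans (*-congʳ (weightedPairSum-middle (s≤s j<m))) (zeroˡ _))) ⟩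
      (w₀ * y₀ + w * y) * (ι 2 * A * B * C)
        ≈⟨ solve 8 (λ w₀ y₀ w y a b c t →
             (w₀ :* y₀ :+ w :* y) :* (t :* a :* b :* c)
               := t :* w₀ :* y₀ :* (a :* b :* c) :+ t :* w :* (y :* (a :* b :* c)))
             refl w₀ y₀ w y A B C (ι 2) ⟩
      ι 2 * w₀ * y₀ * (A * B * C) + ι 2 * w * (y * (A * B * C))
        ≈⟨ +-cong (*-congʳ (*-cong (weightedPairSum-zero {n} 1≤n) racahFactor-zero))
                  (*-congʳ (weightedPairSum-top {n} 1≤n)) ⟩
      1# * 1# * (A * B * C) + f * f * (y * (A * B * C))
        ≈⟨ +-cong (trans (*-congʳ (*-identityˡ 1#)) (*-identityˡ _))
                  (solve 5 (λ f y a b c →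
                     f :* f :* (y :* (a :* b :* c)) := f :* (y :* (f :* a :* b :* c)))
                     refl f y A B C) ⟩
      A * B * C + f * (y * racahDenominator n)
        ≈⟨ +-congˡ (*-congˡ (x/y*y≈x denominator≉0)) ⟩
      A * B * C + f * racahNumerator n
        ≈⟨ +-comm _ _ ⟩
      f * racahNumerator n + A * B * C
        ≈⟨ +-congʳ (*-assoc f _ _) ⟨
      f * poch (- x) n * poch (x + γ + δ + 1#) n + A * B * C   ∎
      where
      1≤n : 1 ≤ n
      1≤n = s≤s z≤n
      A B C f w₀ y₀ w y : Carrier
      A = poch (α + 1#) n
      B = poch (β + δ + 1#) n
      C = poch (γ + 1#) n
      f = ι (n !)
      w₀ = weightedPairSum n 0
      y₀ = racahFactor 0
      w = weightedPairSum n n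
      y = racahFactor n
      denominator≉0 : ¬ racahDenominator n ≈ 0#
      denominator≉0 = *-≉0 (*-≉0 (*-≉0 (ι≉0 (ℕP.1≤n! n)) a≉0) b≉0) c≉0

mainTheorem12 : ∀ {c ℓ} (F : Field c ℓ) → CharZero F →
    let open Field F
        open FieldOps F
    in (N : ℕ) (α β γ δ x : Carrier) →
       α + β ≈ - 1# →
       (α + 1# ≈ - ι N ⊎ β + δ + 1# ≈ - ι N ⊎ γ + 1# ≈ - ι N) →
       RacahWellDefined F N α β γ δ →
       (n : ℕ) → n ≤ N →
       sumTo n (λ k → (poch (- ι n) k / poch (1# + ι n) k) * racah α β γ δ k x)
         ≈ ((ι (n !) * poch (- x) n * poch (x + γ + δ + 1#) n
              + poch (α + 1#) n * poch (β + δ + 1#) n * poch (γ + 1#) n)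
            / (ι 2 * poch (α + 1#) n * poch (β + δ + 1#) n * poch (γ + 1#) n))
mainTheorem12 F cz N α β γ δ x α+β≈-1 _ wellDefined n n≤N with wellDefined n n≤N
... | a≉0 , b≉0 , c≉0 = trans (weighted-racah-sum α+β≈-1 n)
  (x*y≈z⇒x≈z/y (*-≉0 (*-≉0 (*-≉0 (ι≉0 {2} (s≤s z≤n)) a≉0) b≉0) c≉0)
    (closed-form-times-denominator n a≉0 b≉0 c≉0))
  where
  open Field F using (trans)
  open FieldLemmas F using (*-≉0; x*y≈z⇒x≈z/y)
  open RacahLemmas F cz using (ι≉0; module Racah)
  open Racah α β γ δ x using (weighted-racah-sum; closed-form-times-denominator)
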